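{- Let $A\subseteq[n]$ with $|A|=m$, let $v,w\in W_A$, and suppose that $(v,\mathfrak{I})$ is a valid pair. If $\lambda(v,\mathfrak{I})=\overline{w}$, then $v=w$ and $\mathfrak{I}=\operatorname{maxinv}(v)$.
   Context: Notation: $[k]=\{1,\dots,k\}$, $[i,j]=\{i,i+1,\dots,j\}$ (empty if $i>j$). For $A=\{a_1<\dots<a_m\}\subseteq[n]$, $W_A$ is the set of words $w=w_1\cdots w_m$ in which each element of $A$ appears exactly once (i.e. $w=a_{\alpha_1}\cdots a_{\alpha_m}$ for a permutation $\alpha$ of $[m]$); $w([i,j])=\{w_i,\dots,w_j\}$, the subword $w_i\cdots w_j$ is denoted $w_{[i,j]}$, and $w^{ -1}\colon A\to[m]$ is given by $w^{ -1}(w_i)=i$. Contraction: for $w\in W_A$, $\overline{w}\colon A\to[m]$ is $\overline{w}(a)=w^{ -1}(a)-|\{b\in A: b>a,\ w^{ -1}(b)<w^{ -1}(a)\}|$; for a subword $u=w_{[i,j]}$, $\overline{u}$ is the contraction of $u$ regarded as a word in $W_B$ with $B=w([i,j])$. Valid pair: a pair $(w,\mathfrak{I})$ with $w\in W_A$ and $\mathfrak{I}=\{[o_1,c_1],\dots,[o_k,c_k]\}$ ($k\ge0$) where $1\le o_i<c_i\le m$, $o_1<\dots<o_k$, $c_1<\dots<c_k$, and $w_{o_i}>w_{c_i}$ for all $i$. The labeling of a valid pair: $\lambda(w,\mathfrak{I})\colon A\to[m]$ is defined, for $i=w_j$, by $\lambda(w,\mathfrak{I})(i)=j$ if $j$ lies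 in none of the intervals $[o_1,c_1],\dots,[o_k,c_k]$, and otherwise $\lambda(w,\mathfrak{I})(i)=o_\ell-1+\overline{w_{[o_\ell,c_\ell]}}(i)$ where $\ell$ is the least index with $j\in[o_\ell,c_\ell]$. Inversions: $\operatorname{inv}(w)=\{(i,j): i<j,\ w_i>w_j\}$, partially ordered by $(i,j)\le(k,\ell)$ iff $[i,j]\subseteq[k,\ell]$; $\operatorname{maxinv}(w)$ is the set of maximal elements of $\operatorname{inv}(w)$, each pair $(i,j)$ identified with the interval $[i,j]$. -}

module Defs where

open import Data.Nat using (ℕ; zero; suc; _+_; _∸_; _≤_; _<_; _<ᵇ_; _≡ᵇ_)
open import Data.Bool using (Bool; true; false; if_then_else_; _∧_)
open import Data.List using (List; []; _∷_; length; filter; take; drop)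
open import Data.List.Relation.Unary.All using (All)
open import Data.List.Relation.Unary.Linked using (Linked)
open import Data.Product using (_×_; _,_; Σ; ∃)
open import Relation.Nullary using (¬_)
open import Relation.Nullary.Decidable using (yes; no; _×-dec_)
open import Relation.Binary.PropositionalEquality using (_≡_)
import Data.Nat.Properties as ℕP

-- Words are lists of naturals; positions are 1-indexed.

-- w_i  (1-indexed; 0 if out of range, only used within range)
at : List ℕ → ℕ → ℕ
at []       _             = 0
at (x ∷ xs) zero          = 0
at (x ∷ xs) (suc zero)    = x
at (x ∷ xs) (suc (suc i)) = at xs (suc i)

index : List ℕ → ℕ → ℕ
index []       a = 0
index (x ∷ xs) a = if x ≡ᵇ a then 1 else suc (index xs a)

-- contraction: w̄(a) = w⁻¹(a) − |{b ∈ w : b > a, w⁻¹(b) < w⁻¹(a)}|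
contr : List ℕ → ℕ → ℕ
contr w a = index w a ∸ length (filter (λ b → (a ℕP.<? b) ×-dec (index w b ℕP.<? index w a)) w)

-- subword w_{[i,j]} = w_i ⋯ w_j
sub : List ℕ → ℕ → ℕ → List ℕ
sub w i j = take (suc j ∸ i) (drop (i ∸ 1) w)

-- A ⊆ [n], listed in strictly increasing order (a₁ < ⋯ < a_m)
IsSubsetOf[n] : ℕ → List ℕ → Set
IsSubsetOf[n] n A = Linked _<_ A × All (λ a → 1 ≤ a × a ≤ n) A

-- W_A: words in which each element of A appears exactly once
open import Data.List.Relation.Binary.Permutation.Propositional using (_↭_)
InW : List ℕ → List ℕ → Set
InW A w = w ↭ A

-- an interval [o, c] is a pair (o , c); a family 𝔍 is listed as [o₁,c₁],…,[o_k,c_k]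
Interval : Set
Interval = ℕ × ℕ

ValidPair : List ℕ → List Interval → Set
ValidPair w 𝔍 =
  All (λ { (o , c) → 1 ≤ o × o < c × c ≤ length w × at w c < at w o }) 𝔍
  × Linked (λ { (o , c) (o' , c') → o < o' × c < c' }) 𝔍

-- labeling λ(w,𝔍)(i): the first interval in the list (least ℓ) containing j = w⁻¹(i)
labelAux : List ℕ → List Interval → ℕ → ℕ → ℕ
labelAux w []            j i = j
labelAux w ((o , c) ∷ 𝔍) j i with o ℕP.≤? j | j ℕP.≤? c
... | yes _ | yes _ = (o ∸ 1) + contr (sub w o c) i
... | _     | _     = labelAux w 𝔍 j i

label : List ℕ → List Interval → ℕ → ℕ
label w 𝔍 i = labelAux w 𝔍 (index w i) i

Inv : List ℕ → ℕ → ℕ → Set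
Inv w i j = 1 ≤ i × i < j × j ≤ length w × at w j < at w i

MaxInv : List ℕ → ℕ → ℕ → Set
MaxInv w i j = Inv w i j ×
  (∀ k l → Inv w k l → k ≤ i → j ≤ l → (k ≡ i × l ≡ j))

module Submission where

-- The contraction of
-- a word u at a is 1 + |{earlier letters of u smaller than a}|
-- (contr-as-count); hence a word is determined by its alphabet and its
-- contraction (contr-injective), and ū(a) ≤ 1 + |{letters smaller than a}|
-- (contr-≤-smaller).  Writing s(p) (`opening`) for the opening of the first
-- member of 𝔍 containing the position p, or p if there is none, the label of
-- v_p is s(p) + |{i ∈ [s(p), p) : v_i < v_p}| (label-as-count).
-- The heart of the proof (FromLabelling.no-larger-left) is that no letter of v
-- left of s(p) exceeds v_p, by strong induction on v_p: a larger letter on the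
-- left would, by the bound on w̄, force a smaller letter v_i right of p, for
-- which the claim fails.  Consequently λ(v, 𝔍) = v̄, so v̄ = w̄ and v = w; and
-- every inversion (k, l) of v lies in the member [s(l), c] of 𝔍, which
-- identifies 𝔍 with the maximal inversions of v.

open import Defs
open import Data.Bool using (Bool; true; false; not; T; _∧_)
open import Data.Bool.Properties using (∧-identityʳ; ∧-zeroʳ)
open import Data.List using (List; []; _∷_; length; filter; take; drop)
open import Data.List.Membership.Propositional using (_∈_)
open import Data.List.Relation.Unary.All as All using (All; []; _∷_)
open import Data.List.Relation.Unary.AllPairs as AllPairs using (AllPairs; []; _∷_)
open import Data.List.Relation.Unary.Any using (here; there)
import Data.List.Relation.Unary.Linked as Linked
open import Data.List.Relation.Unary.Linked.Properties using (Linked⇒AllPairs)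
open import Data.List.Relation.Unary.Unique.Propositional using (Unique)
open import Data.List.Relation.Unary.Unique.Propositional.Properties using (take⁺; drop⁺)
open import Data.List.Relation.Binary.Permutation.Propositional
  using (_↭_; ↭-sym; ↭-trans; ↭⇒↭ₛ)
open import Data.List.Relation.Binary.Permutation.Propositional.Properties
  using (∈-resp-↭; ↭-length; filter-↭; drop-mid)
import Data.List.Relation.Binary.Permutation.Setoid.Properties as SetoidPermutation
open import Data.Nat using (ℕ; zero; suc; _+_; _∸_; _≤_; _<_; _≡ᵇ_; z≤n; s≤s; z<s; >-nonZero)
open import Data.Nat.Induction using (<-rec)
open import Data.Nat.Properties
open import Data.Product using (_×_; _,_; ∃; proj₁; proj₂)
open import Data.Sum using (inj₁; inj₂)
open import Data.Unit using (tt)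
open import Function.Bundles using (_⇔_; mk⇔)
open import Relation.Nullary using (¬_; Dec; yes; no; does; contradiction)
open import Relation.Nullary.Decidable using (dec-true; dec-false; _×-dec_)
open import Relation.Binary.Definitions using (tri<; tri≈; tri>)
open import Relation.Binary.PropositionalEquality

bit : Bool → ℕ
bit true  = 1
bit false = 0

count : (ℕ → Bool) → ℕ → ℕ → ℕ
count f s zero    = 0
count f s (suc n) = bit (f s) + count f (suc s) n

InRange : ℕ → ℕ → (ℕ → Set) → Set
InRange s n P = ∀ i → s ≤ i → i < s + n → P i

range-head : ∀ {s n P} → InRange s (suc n) P → P s
range-head {s} h = h s ≤-refl (m<m+n s z<s)

range-tail : ∀ {s n P} → InRange s (suc n) P → InRange (suc s) n P
range-tail {s} {n} h i s<i i<1+s+n =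
  h i (≤-trans (n≤1+n s) s<i) (subst (i <_) (sym (+-suc s n)) i<1+s+n)

count-≤ : ∀ f s n → count f s n ≤ n
count-≤ f s zero    = z≤n
count-≤ f s (suc n) with f s
... | true  = s≤s (count-≤ f (suc s) n)
... | false = m≤n⇒m≤1+n (count-≤ f (suc s) n)

count-++ : ∀ f s n k → count f s (n + k) ≡ count f s n + count f (s + n) k
count-++ f s zero    k rewrite +-identityʳ s = refl
count-++ f s (suc n) k rewrite count-++ f (suc s) n k | +-suc s n =
  sym (+-assoc (bit (f s)) (count f (suc s) n) (count f (suc (s + n)) k))

count-cong : ∀ f g s n → InRange s n (λ i → f i ≡ g i) → count f s n ≡ count g s n
count-cong f g s zero    h = refl
count-cong f g s (suc n) h =
  cong₂ _+_ (cong bit (range-head h)) (count-cong f g (suc s) n (range-tail h))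

count-shift : ∀ f d s n → count f (d + s) n ≡ count (λ i → f (d + i)) s n
count-shift f d s zero    = refl
count-shift f d s (suc n) = cong (bit (f (d + s)) +_)
  (trans (cong (λ t → count f t n) (sym (+-suc d s))) (count-shift f d (suc s) n))

count-all : ∀ f s n → InRange s n (λ i → f i ≡ true) → count f s n ≡ n
count-all f s zero    h = refl
count-all f s (suc n) h rewrite range-head h = cong suc (count-all f (suc s) n (range-tail h))

count-none : ∀ f s n → InRange s n (λ i → f i ≡ false) → count f s n ≡ 0
count-none f s zero    h = refl
count-none f s (suc n) h rewrite range-head h = count-none f (suc s) n (range-tail h)

count-complement : ∀ f g s n → InRange s n (λ i → f i ≡ not (g i)) →
  count f s n + count g s n ≡ n
count-complement f g s zero    h = refl
count-complement f g s (suc n) h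
  with g s | range-head h | count-complement f g (suc s) n (range-tail h)
... | true  | fs | ih rewrite fs = trans (+-suc _ _) (cong suc ih)
... | false | fs | ih rewrite fs = cong suc ih

count-witness : ∀ f s n → 0 < count f s n → ∃ λ i → s ≤ i × i < s + n × f i ≡ true
count-witness f s (suc n) pos with f s in eq
... | true  = s , ≤-refl , m<m+n s z<s , eq
... | false with count-witness f (suc s) n pos
... | i , s<i , i<1+s+n , fi =
  i , ≤-trans (n≤1+n s) s<i , subst (i <_) (sym (+-suc s n)) i<1+s+n , fi

count-< : ∀ f s n i → s ≤ i → i < s + n → f i ≡ false → count f s n < n
count-< f s zero    i s≤i i<s+0 fi =
  contradiction (subst (i <_) (+-identityʳ s) i<s+0) (≤⇒≯ s≤i)
count-< f s (suc n) i s≤i i<s+n fi with s ≟ i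
... | yes refl rewrite fi = s≤s (count-≤ f (suc s) n)
... | no s≢i = bit+< (f s)
  (count-< f (suc s) n i (≤∧≢⇒< s≤i s≢i) (subst (i <_) (+-suc s n) i<s+n) fi)
  where
  bit+< : ∀ b {x n} → x < n → bit b + x < suc n
  bit+< true  x<n = s≤s x<n
  bit+< false x<n = m<n⇒m<1+n x<n

count-mono : ∀ f s {n k} → n ≤ k → count f s n ≤ count f s k
count-mono f s {n} n≤k with m≤n⇒∃[o]m+o≡n n≤k
... | d , refl rewrite count-++ f s n d = m≤m+n _ _

count-split : ∀ f {s p} → 1 ≤ s → s ≤ p →
  count f 1 (p ∸ 1) ≡ count f 1 (s ∸ 1) + count f s (p ∸ s)
count-split f {suc s'} _ s≤p with m≤n⇒∃[o]m+o≡n s≤p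
... | q , refl = trans (count-++ f 1 s' q)
  (cong (λ t → count f 1 s' + count f (suc s') t) (sym (m+n∸m≡n (suc s') q)))

count-around : ∀ f {p m} → 1 ≤ p → p ≤ m →
  count f 1 m ≡ count f 1 (p ∸ 1) + (bit (f p) + count f (suc p) (m ∸ p))
count-around f {suc p'} _ p≤m with m≤n⇒∃[o]m+o≡n p≤m
... | r , refl = begin
  count f 1 (suc p' + r)      ≡⟨ cong (count f 1) (sym (+-suc p' r)) ⟩
  count f 1 (p' + suc r)      ≡⟨ count-++ f 1 p' (suc r) ⟩
  count f 1 p' + count f (suc p') (suc r)
    ≡⟨ cong (λ t → count f 1 p' + (bit (f (suc p')) + count f (suc (suc p')) t))
            (sym (m+n∸m≡n (suc p') r)) ⟩
  count f 1 p' + (bit (f (suc p')) + count f (suc (suc p')) (suc p' + r ∸ suc p')) ∎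
  where open ≡-Reasoning

index-≢ : ∀ x xs a → x ≢ a → index (x ∷ xs) a ≡ suc (index xs a)
index-≢ x xs a x≢a rewrite dec-false (x ≟ a) x≢a = refl

index-head : ∀ x xs → index (x ∷ xs) x ≡ 1
index-head x xs rewrite dec-true (x ≟ x) refl = refl

index-bounds : ∀ u a → a ∈ u → 1 ≤ index u a × index u a ≤ length u
index-bounds (x ∷ xs) a a∈ with x ≡ᵇ a in e
... | true = s≤s z≤n , s≤s z≤n
index-bounds (x ∷ xs) a (here refl) | false = contradiction (trans (sym e) (dec-true (x ≟ x) refl)) λ ()
index-bounds (x ∷ xs) a (there a∈) | false = s≤s z≤n , s≤s (proj₂ (index-bounds xs a a∈))

at-index : ∀ u a → a ∈ u → at u (index u a) ≡ a
at-index (x ∷ xs) a a∈ with x ≡ᵇ a in e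
... | true = ≡ᵇ⇒≡ x a (subst T (sym e) tt)
at-index (x ∷ xs) a (here refl) | false = contradiction (trans (sym e) (dec-true (x ≟ x) refl)) λ ()
at-index (x ∷ xs) a (there a∈) | false with index xs a | index-bounds xs a a∈ | at-index xs a a∈
... | suc k | _ | ih = ih

at-∈ : ∀ u k → 1 ≤ k → k ≤ length u → at u k ∈ u
at-∈ (x ∷ xs) (suc zero)    _ _       = here refl
at-∈ (x ∷ xs) (suc (suc k)) _ (s≤s k≤) = there (at-∈ xs (suc k) (s≤s z≤n) k≤)

index-at : ∀ u k → Unique u → 1 ≤ k → k ≤ length u → index u (at u k) ≡ k
index-at (x ∷ xs) (suc zero)    _             _ _        = index-head x xs
index-at (x ∷ xs) (suc (suc k)) (x∉xs ∷ uxs) _ (s≤s k≤) =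
  trans (index-≢ x xs _ (All.lookup x∉xs (at-∈ xs (suc k) (s≤s z≤n) k≤)))
        (cong suc (index-at xs (suc k) uxs (s≤s z≤n) k≤))

at-injective : ∀ u {k l} → Unique u → 1 ≤ k → k ≤ length u → 1 ≤ l → l ≤ length u →
  at u k ≡ at u l → k ≡ l
at-injective u {k} {l} uu k1 km l1 lm e =
  trans (sym (index-at u k uu k1 km)) (trans (cong (index u) e) (index-at u l uu l1 lm))

at-drop : ∀ d u i → at (drop d u) (suc i) ≡ at u (d + suc i)
at-drop zero    u        i = refl
at-drop (suc d) []       i = refl
at-drop (suc d) (x ∷ xs) i rewrite +-suc d i =
  trans (at-drop d xs i) (cong (at xs) (+-suc d i))

at-take : ∀ n u i → i ≤ n → at (take n u) i ≡ at u i
at-take zero    []       zero          _        = refl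
at-take zero    (x ∷ u)  zero          _        = refl
at-take (suc n) []       i             _        = refl
at-take (suc n) (x ∷ xs) zero          _        = refl
at-take (suc n) (x ∷ xs) (suc zero)    _        = refl
at-take (suc n) (x ∷ xs) (suc (suc i)) (s≤s i≤) = at-take n xs (suc i) i≤

length-take : ∀ n (xs : List ℕ) k → k ≤ n → k ≤ length xs → k ≤ length (take n xs)
length-take n       xs       zero    _        _        = z≤n
length-take (suc n) (x ∷ xs) (suc k) (s≤s k≤) (s≤s k≤′) = s≤s (length-take n xs k k≤ k≤′)

length-drop : ∀ d (xs : List ℕ) k → d + k ≤ length xs → k ≤ length (drop d xs)
length-drop zero    xs       k d+k≤       = d+k≤
length-drop (suc d) (x ∷ xs) k (s≤s d+k≤) = length-drop d xs k d+k≤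

less : ℕ → ℕ → Bool
less x y = does (x <? y)

less-sound : ∀ {x y} → less x y ≡ true → x < y
less-sound {x} {y} e = <ᵇ⇒< x y (subst T (sym e) tt)

less-flip : ∀ x y → x ≢ y → less x y ≡ not (less y x)
less-flip x y x≢y with <-cmp x y
... | tri< x<y _ y≮x = trans (dec-true (x <? y) x<y) (sym (cong not (dec-false (y <? x) y≮x)))
... | tri≈ _ x≡y _   = contradiction x≡y x≢y
... | tri> x≮y _ y<x = trans (dec-false (x <? y) x≮y) (sym (cong not (dec-true (y <? x) y<x)))

count-tail : ∀ (g : ℕ → Bool) x xs n →
  count (λ i → g (at (x ∷ xs) i)) 2 n ≡ count (λ i → g (at xs i)) 1 n
count-tail g x xs n = trans (count-shift (λ i → g (at (x ∷ xs) i)) 1 1 n)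
  (count-cong _ _ 1 n λ { (suc i) _ _ → refl })

filter-count : ∀ {P : ℕ → Set} (P? : ∀ x → Dec (P x)) u →
  length (filter P? u) ≡ count (λ i → does (P? (at u i))) 1 (length u)
filter-count P? []       = refl
filter-count P? (x ∷ xs) with does (P? x)
... | true  = cong suc (trans (filter-count P? xs) (sym (count-tail (λ y → does (P? y)) x xs (length xs))))
... | false = trans (filter-count P? xs) (sym (count-tail (λ y → does (P? y)) x xs (length xs)))

suc-∸1 : ∀ {p} → 1 ≤ p → suc (p ∸ 1) ≡ p
suc-∸1 {p} p≥1 = suc-pred p {{>-nonZero p≥1}}

-- ū(a) = 1 + |{ i < u⁻¹(a) : u_i < a }|: of the u⁻¹(a) − 1 entries before a,
-- contraction removes exactly those larger than a
contr-as-count : ∀ u a → Unique u → a ∈ u →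
  contr u a ≡ suc (count (λ i → less (at u i) a) 1 (index u a ∸ 1))
contr-as-count u a uu a∈u = begin
  contr u a
    ≡⟨ cong (p ∸_) earlier-larger ⟩
  p ∸ count larger 1 (p ∸ 1)
    ≡⟨ cong (_∸ count larger 1 (p ∸ 1)) (trans (sym (suc-∸1 p≥1)) (cong suc (sym complement))) ⟩
  suc (count smaller 1 (p ∸ 1) + count larger 1 (p ∸ 1)) ∸ count larger 1 (p ∸ 1)
    ≡⟨ m+n∸n≡m (suc (count smaller 1 (p ∸ 1))) (count larger 1 (p ∸ 1)) ⟩
  suc (count smaller 1 (p ∸ 1)) ∎
  where
  open ≡-Reasoning
  p = index u a
  m = length u
  p≥1 = proj₁ (index-bounds u a a∈u)
  p≤m = proj₂ (index-bounds u a a∈u)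
  smaller larger earlier-larger? : ℕ → Bool
  smaller i = less (at u i) a
  larger i = less a (at u i)
  earlier-larger? i = larger i ∧ less i p

  earlier-larger :
    length (filter (λ b → (a <? b) ×-dec (index u b <? p)) u) ≡ count larger 1 (p ∸ 1)
  earlier-larger = begin
    length (filter (λ b → (a <? b) ×-dec (index u b <? p)) u)
      ≡⟨ filter-count (λ b → (a <? b) ×-dec (index u b <? p)) u ⟩
    count (λ i → larger i ∧ less (index u (at u i)) p) 1 m
      ≡⟨ count-cong _ earlier-larger? 1 m (λ i i≥1 i≤m →
           cong (λ t → larger i ∧ less t p) (index-at u i uu i≥1 (≤-pred i≤m))) ⟩
    count earlier-larger? 1 m
      ≡⟨ count-around earlier-larger? p≥1 p≤m ⟩
    count earlier-larger? 1 (p ∸ 1) + (bit (earlier-larger? p) + count earlier-larger? (suc p) (m ∸ p))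
      ≡⟨ cong₂ _+_ left (cong₂ _+_ (cong bit (∧-zeroʳ-at p (<-irrefl refl))) right) ⟩
    count larger 1 (p ∸ 1) + 0
      ≡⟨ +-identityʳ _ ⟩
    count larger 1 (p ∸ 1) ∎
    where
    ∧-zeroʳ-at : ∀ i → ¬ i < p → earlier-larger? i ≡ false
    ∧-zeroʳ-at i i≮p = trans (cong (larger i ∧_) (dec-false (i <? p) i≮p)) (∧-zeroʳ _)
    left : count earlier-larger? 1 (p ∸ 1) ≡ count larger 1 (p ∸ 1)
    left = count-cong _ _ 1 (p ∸ 1) λ i _ i<p →
      trans (cong (larger i ∧_) (dec-true (i <? p) (subst (i <_) (suc-∸1 p≥1) i<p))) (∧-identityʳ _)
    right : count earlier-larger? (suc p) (m ∸ p) ≡ 0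
    right = count-none _ (suc p) (m ∸ p) λ i p<i _ → ∧-zeroʳ-at i (<⇒≯ p<i)

  complement : count smaller 1 (p ∸ 1) + count larger 1 (p ∸ 1) ≡ p ∸ 1
  complement = count-complement smaller larger 1 (p ∸ 1) λ i i≥1 i<p →
    let i<p′ = subst (i <_) (suc-∸1 p≥1) i<p in
    less-flip (at u i) a λ ui≡a → <-irrefl
      (at-injective u uu i≥1 (≤-trans (<⇒≤ i<p′) p≤m) p≥1 p≤m (trans ui≡a (sym (at-index u a a∈u))))
      i<p′

contr-≥1 : ∀ u a → Unique u → a ∈ u → 1 ≤ contr u a
contr-≥1 u a uu a∈u = subst (1 ≤_) (sym (contr-as-count u a uu a∈u)) (s≤s z≤n)

contr-head : ∀ x xs → Unique (x ∷ xs) → contr (x ∷ xs) x ≡ 1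
contr-head x xs uu = trans (contr-as-count (x ∷ xs) x uu (here refl))
  (cong (λ t → suc (count (λ i → less (at (x ∷ xs) i) x) 1 (t ∸ 1))) (index-head x xs))

contr-cons : ∀ x xs a → Unique (x ∷ xs) → a ∈ xs → contr (x ∷ xs) a ≡ bit (less x a) + contr xs a
contr-cons x xs a uu@(x∉xs ∷ uxs) a∈xs = begin
  contr (x ∷ xs) a
    ≡⟨ contr-as-count (x ∷ xs) a uu (there a∈xs) ⟩
  suc (count smaller′ 1 (index (x ∷ xs) a ∸ 1))
    ≡⟨ cong (λ t → suc (count smaller′ 1 (t ∸ 1))) (index-≢ x xs a (All.lookup x∉xs a∈xs)) ⟩
  suc (count smaller′ 1 (index xs a))
    ≡⟨ cong (λ t → suc (count smaller′ 1 t)) (sym (suc-∸1 (proj₁ (index-bounds xs a a∈xs)))) ⟩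
  suc (bit (less x a) + count smaller′ 2 (index xs a ∸ 1))
    ≡⟨ cong (λ t → suc (bit (less x a) + t)) (count-tail (λ y → less y a) x xs (index xs a ∸ 1)) ⟩
  suc (bit (less x a) + count smaller 1 (index xs a ∸ 1))
    ≡⟨ sym (+-suc (bit (less x a)) _) ⟩
  bit (less x a) + suc (count smaller 1 (index xs a ∸ 1))
    ≡⟨ cong (bit (less x a) +_) (sym (contr-as-count xs a uxs a∈xs)) ⟩
  bit (less x a) + contr xs a ∎
  where
  open ≡-Reasoning
  smaller smaller′ : ℕ → Bool
  smaller i = less (at xs i) a
  smaller′ i = less (at (x ∷ xs) i) a

contr-≤-smaller : ∀ u a → Unique u → a ∈ u → contr u a ≤ suc (length (filter (λ b → b <? a) u))
contr-≤-smaller u a uu a∈u = begin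
  contr u a
    ≡⟨ contr-as-count u a uu a∈u ⟩
  suc (count smaller 1 (index u a ∸ 1))
    ≤⟨ s≤s (count-mono smaller 1 (≤-trans (m∸n≤m _ 1) (proj₂ (index-bounds u a a∈u)))) ⟩
  suc (count smaller 1 (length u))
    ≡⟨ cong suc (sym (filter-count (λ b → b <? a) u)) ⟩
  suc (length (filter (λ b → b <? a) u)) ∎
  where
  open ≤-Reasoning
  smaller : ℕ → Bool
  smaller i = less (at u i) a

contr≡1⇒head-≮ : ∀ x xs y → Unique (x ∷ xs) → y ∈ xs → contr (x ∷ xs) y ≡ 1 → ¬ x < y
contr≡1⇒head-≮ x xs y uu@(_ ∷ uxs) y∈xs c≡1 x<y = <-irrefl (sym c≡1) (begin-strict
  1                             <⟨ s≤s (contr-≥1 xs y uxs y∈xs) ⟩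
  suc (contr xs y)              ≡⟨ cong (λ b → bit b + contr xs y) (sym (dec-true (x <? y) x<y)) ⟩
  bit (less x y) + contr xs y   ≡⟨ sym (contr-cons x xs y uu y∈xs) ⟩
  contr (x ∷ xs) y              ∎)
  where open ≤-Reasoning

unique-resp-↭ : ∀ {xs ys : List ℕ} → xs ↭ ys → Unique xs → Unique ys
unique-resp-↭ p = SetoidPermutation.Unique-resp-↭ (setoid ℕ) (↭⇒↭ₛ p)

contr-injective : ∀ v w → Unique v → Unique w → v ↭ w →
  (∀ a → a ∈ v → contr v a ≡ contr w a) → v ≡ w
contr-injective []       []       _ _ _ _ = refl
contr-injective []       (y ∷ ys) _ _ p _ with ↭-length p
... | ()
contr-injective (x ∷ xs) []       _ _ p _ with ↭-length p
... | ()
contr-injective (x ∷ xs) (y ∷ ys) uv@(_ ∷ uxs) uw@(_ ∷ uys) p same with x ≟ y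
... | yes refl = cong (x ∷_) (contr-injective xs ys uxs uys xs↭ys same-tail)
  where
  xs↭ys : xs ↭ ys
  xs↭ys = drop-mid [] [] p
  same-tail : ∀ a → a ∈ xs → contr xs a ≡ contr ys a
  same-tail a a∈xs = +-cancelˡ-≡ (bit (less x a)) _ _ (begin
    bit (less x a) + contr xs a ≡⟨ sym (contr-cons x xs a uv a∈xs) ⟩
    contr (x ∷ xs) a            ≡⟨ same a (there a∈xs) ⟩
    contr (x ∷ ys) a            ≡⟨ contr-cons x ys a uw (∈-resp-↭ xs↭ys a∈xs) ⟩
    bit (less x a) + contr ys a ∎)
    where open ≡-Reasoning
... | no x≢y = contradiction (≤-antisym (≮⇒≥ y≮x) (≮⇒≥ x≮y)) x≢y
  where
  ∈-tail : ∀ {a b} {bs : List ℕ} → a ∈ b ∷ bs → a ≢ b → a ∈ bs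
  ∈-tail (here a≡b) a≢b = contradiction a≡b a≢b
  ∈-tail (there a∈) _   = a∈
  y∈xs : y ∈ xs
  y∈xs = ∈-tail (∈-resp-↭ (↭-sym p) (here refl)) (λ y≡x → x≢y (sym y≡x))
  x∈ys : x ∈ ys
  x∈ys = ∈-tail (∈-resp-↭ p (here refl)) x≢y
  x≮y : ¬ x < y
  x≮y = contr≡1⇒head-≮ x xs y uv y∈xs (trans (same y (there y∈xs)) (contr-head y ys uw))
  y≮x : ¬ y < x
  y≮x = contr≡1⇒head-≮ y ys x uw x∈ys (trans (sym (same x (here refl))) (contr-head x xs uv))

contr-sub : ∀ v {o j c} → Unique v → 1 ≤ o → o ≤ j → j ≤ c → c ≤ length v →
  contr (sub v o c) (at v j) ≡ suc (count (λ i → less (at v i) (at v j)) o (j ∸ o))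
contr-sub v {suc o'} uv _ o≤j j≤c c≤m with m≤n⇒∃[o]m+o≡n o≤j
... | q , refl with m≤n⇒∃[o]m+o≡n j≤c
... | r , refl = begin
  contr u a
    ≡⟨ contr-as-count u a uu a∈u ⟩
  suc (count (λ i → less (at u i) a) 1 (index u a ∸ 1))
    ≡⟨ cong (λ t → suc (count (λ i → less (at u i) a) 1 (t ∸ 1))) index-a ⟩
  suc (count (λ i → less (at u i) a) 1 q)
    ≡⟨ cong suc (count-cong _ _ 1 q λ { (suc i) _ i≤q →
         cong (λ t → less t a) (at-u i (≤-trans (≤-pred i≤q) (≤-trans (n≤1+n q) q<L))) }) ⟩
  suc (count (λ i → less (at v (o' + i)) a) 1 q)
    ≡⟨ cong suc (sym (count-shift (λ i → less (at v i) a) o' 1 q)) ⟩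
  suc (count (λ i → less (at v i) a) (o' + 1) q)
    ≡⟨ cong (λ t → suc (count (λ i → less (at v i) a) t q)) (+-comm o' 1) ⟩
  suc (count (λ i → less (at v i) a) (suc o') q)
    ≡⟨ cong (λ t → suc (count (λ i → less (at v i) a) (suc o') t)) (sym (m+n∸m≡n (suc o') q)) ⟩
  suc (count (λ i → less (at v i) a) (suc o') (suc o' + q ∸ suc o')) ∎
  where
  open ≡-Reasoning
  -- the subword is take L (drop o' v), and a sits at its position q + 1
  L = suc o' + q + r ∸ o'
  u = sub v (suc o') (suc o' + q + r)
  a = at v (suc o' + q)
  q<L : suc q ≤ L
  q<L = subst (suc q ≤_) (sym L≡) (m≤m+n (suc q) r)
    where
    L≡ : L ≡ suc q + r
    L≡ = trans (cong (_∸ o') (trans (+-assoc (suc o') q r) (sym (+-suc o' (q + r)))))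
               (m+n∸m≡n o' (suc q + r))
  at-u : ∀ i → suc i ≤ L → at u (suc i) ≡ at v (o' + suc i)
  at-u i i<L = trans (at-take L (drop o' v) (suc i) i<L) (at-drop o' v i)
  at-u-q : at u (suc q) ≡ a
  at-u-q = trans (at-u q q<L) (cong (at v) (+-suc o' q))
  uu : Unique u
  uu = take⁺ L (drop⁺ o' uv)
  q<|u| : suc q ≤ length u
  q<|u| = length-take L (drop o' v) (suc q) q<L (length-drop o' v (suc q)
    (≤-trans (≤-reflexive (+-suc o' q)) (≤-trans (m≤m+n (suc o' + q) r) c≤m)))
  a∈u : a ∈ u
  a∈u = subst (_∈ u) at-u-q (at-∈ u (suc q) (s≤s z≤n) q<|u|)
  index-a : index u a ≡ suc q
  index-a = trans (cong (index u) (sym at-u-q)) (index-at u (suc q) uu (s≤s z≤n) q<|u|)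

Precedes : Interval → Interval → Set
Precedes (o , c) (o′ , c′) = o < o′ × c < c′

opening : List Interval → ℕ → ℕ
opening []            j = j
opening ((o , c) ∷ 𝔍) j with o ≤? j | j ≤? c
... | yes _ | yes _ = o
... | _     | _     = opening 𝔍 j

opening-≤ : ∀ 𝔍 j → opening 𝔍 j ≤ j
opening-≤ []            j = ≤-refl
opening-≤ ((o , c) ∷ 𝔍) j with o ≤? j | j ≤? c
... | yes o≤j | yes _ = o≤j
... | yes _   | no _  = opening-≤ 𝔍 j
... | no _    | _     = opening-≤ 𝔍 j

opening-≥1 : ∀ 𝔍 j → All (λ x → 1 ≤ proj₁ x) 𝔍 → 1 ≤ j → 1 ≤ opening 𝔍 j
opening-≥1 []            j _            j≥1 = j≥1
opening-≥1 ((o , c) ∷ 𝔍) j (o≥1 ∷ rest) j≥1 with o ≤? j | j ≤? c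
... | yes _ | yes _ = o≥1
... | yes _ | no _  = opening-≥1 𝔍 j rest j≥1
... | no _  | _     = opening-≥1 𝔍 j rest j≥1

opening-member : ∀ 𝔍 j → opening 𝔍 j < j → ∃ λ c → (opening 𝔍 j , c) ∈ 𝔍 × j ≤ c
opening-member []            j s<j = contradiction s<j (<-irrefl refl)
opening-member ((o , c) ∷ 𝔍) j s<j with o ≤? j | j ≤? c
... | yes _ | yes j≤c = c , here refl , j≤c
... | yes _ | no _    = let c′ , mem , j≤c′ = opening-member 𝔍 j s<j in c′ , there mem , j≤c′
... | no _  | _       = let c′ , mem , j≤c′ = opening-member 𝔍 j s<j in c′ , there mem , j≤c′

opening-minimal : ∀ 𝔍 {j o c} → AllPairs Precedes 𝔍 → (o , c) ∈ 𝔍 → o ≤ j → j ≤ c →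
  opening 𝔍 j ≤ o
opening-minimal ((o₀ , c₀) ∷ 𝔍) {j} (first ∷ rest) mem o≤j j≤c with o₀ ≤? j | j ≤? c₀ | mem
... | yes _ | yes _   | here refl  = ≤-refl
... | yes _ | yes _   | there mem′ = <⇒≤ (proj₁ (All.lookup first mem′))
... | yes _ | no j≰c₀ | here refl  = contradiction j≤c j≰c₀
... | yes _ | no _    | there mem′ = opening-minimal 𝔍 rest mem′ o≤j j≤c
... | no o₀≰j | _     | here refl  = contradiction o≤j o₀≰j
... | no _  | _       | there mem′ = opening-minimal 𝔍 rest mem′ o≤j j≤c

opening-window : ∀ 𝔍 {i p} → AllPairs Precedes 𝔍 → opening 𝔍 i ≤ p → p ≤ i →
  opening 𝔍 p ≤ opening 𝔍 i
opening-window 𝔍 {i} {p} ordered s≤p p≤i with m≤n⇒m<n∨m≡n (opening-≤ 𝔍 i)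
... | inj₁ s<i = let c , mem , i≤c = opening-member 𝔍 i s<i in
  opening-minimal 𝔍 ordered mem s≤p (≤-trans p≤i i≤c)
... | inj₂ s≡i rewrite ≤-antisym p≤i (subst (_≤ p) s≡i s≤p) = ≤-refl

members-unnested : ∀ 𝔍 {o c o′ c′} → AllPairs Precedes 𝔍 → (o , c) ∈ 𝔍 → (o′ , c′) ∈ 𝔍 →
  o′ ≤ o → c ≤ c′ → o′ ≡ o × c′ ≡ c
members-unnested (_ ∷ 𝔍) (first ∷ rest) (here refl) (here refl) _ _ = refl , refl
members-unnested (_ ∷ 𝔍) (first ∷ rest) (here refl) (there mem′) o′≤o _ =
  contradiction (proj₁ (All.lookup first mem′)) (≤⇒≯ o′≤o)
members-unnested (_ ∷ 𝔍) (first ∷ rest) (there mem) (here refl) _ c≤c′ =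
  contradiction (proj₂ (All.lookup first mem)) (≤⇒≯ c≤c′)
members-unnested (_ ∷ 𝔍) (first ∷ rest) (there mem) (there mem′) o′≤o c≤c′ =
  members-unnested 𝔍 rest mem mem′ o′≤o c≤c′

label-as-count : ∀ v 𝔍 j → Unique v → All (λ x → Inv v (proj₁ x) (proj₂ x)) 𝔍 →
  labelAux v 𝔍 j (at v j)
    ≡ opening 𝔍 j + count (λ i → less (at v i) (at v j)) (opening 𝔍 j) (j ∸ opening 𝔍 j)
label-as-count v []            j uv _ rewrite n∸n≡0 j = sym (+-identityʳ j)
label-as-count v ((o , c) ∷ 𝔍) j uv ((o≥1 , _ , c≤m , _) ∷ invs) with o ≤? j | j ≤? c
... | yes o≤j | yes j≤c =
  trans (cong ((o ∸ 1) +_) (contr-sub v uv o≥1 o≤j j≤c c≤m))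
        (trans (+-suc (o ∸ 1) _) (cong (_+ count (λ i → less (at v i) (at v j)) o (j ∸ o)) (suc-∸1 o≥1)))
... | yes _ | no _ = label-as-count v 𝔍 j uv invs
... | no _  | _    = label-as-count v 𝔍 j uv invs

positive-rest : ∀ {s b r} → s ≤ suc (b + r) → b < s ∸ 1 → 0 < r
positive-rest {suc s′} {b} {zero} s≤1+b b<s′ =
  contradiction (≤-trans (≤-pred s≤1+b) (≤-reflexive (+-identityʳ b))) (<⇒≱ b<s′)
positive-rest {r = suc r} _ _ = z<s

module FromLabelling (v w : List ℕ) (𝔍 : List Interval)
  (v-unique : Unique v) (v↭w : v ↭ w) (valid : ValidPair v 𝔍)
  (labels : ∀ a → a ∈ v → label v 𝔍 a ≡ contr w a) where

  m : ℕ
  m = length v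

  w-unique : Unique w
  w-unique = unique-resp-↭ v↭w v-unique

  members-inv : All (λ x → Inv v (proj₁ x) (proj₂ x)) 𝔍
  members-inv = proj₁ valid

  ordered : AllPairs Precedes 𝔍
  ordered = Linked⇒AllPairs
    (λ (o<o′ , c<c′) (o′<o″ , c′<c″) → <-trans o<o′ o′<o″ , <-trans c<c′ c′<c″)
    (Linked.map (λ r → r) (proj₂ valid))

  opening≥1 : ∀ {p} → 1 ≤ p → 1 ≤ opening 𝔍 p
  opening≥1 {p} = opening-≥1 𝔍 p (All.map proj₁ members-inv)

  smaller : ℕ → ℕ → Bool
  smaller a i = less (at v i) a

  before inside after : ℕ → ℕ
  before p = count (smaller (at v p)) 1 (opening 𝔍 p ∸ 1)
  inside p = count (smaller (at v p)) (opening 𝔍 p) (p ∸ opening 𝔍 p)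
  after  p = count (smaller (at v p)) (suc p) (m ∸ p)

  label-at : ∀ {p} → 1 ≤ p → p ≤ m → opening 𝔍 p + inside p ≡ contr w (at v p)
  label-at {p} p≥1 p≤m = begin
    opening 𝔍 p + inside p   ≡⟨ sym (label-as-count v 𝔍 p v-unique members-inv) ⟩
    labelAux v 𝔍 p (at v p)  ≡⟨ cong (λ t → labelAux v 𝔍 t (at v p)) (sym (index-at v p v-unique p≥1 p≤m)) ⟩
    label v 𝔍 (at v p)       ≡⟨ labels (at v p) (at-∈ v p p≥1 p≤m) ⟩
    contr w (at v p)         ∎
    where open ≡-Reasoning

  contr-v-at : ∀ {p} → 1 ≤ p → p ≤ m → contr v (at v p) ≡ suc (before p + inside p)
  contr-v-at {p} p≥1 p≤m = trans (contr-as-count v (at v p) v-unique (at-∈ v p p≥1 p≤m))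
    (cong suc (trans (cong (λ t → count (smaller (at v p)) 1 (t ∸ 1)) (index-at v p v-unique p≥1 p≤m))
                     (count-split (smaller (at v p)) (opening≥1 p≥1) (opening-≤ 𝔍 p))))

  contr-w-bound : ∀ {p} → 1 ≤ p → p ≤ m → contr w (at v p) ≤ suc (before p + inside p + after p)
  contr-w-bound {p} p≥1 p≤m = begin
    contr w a                                     ≤⟨ contr-≤-smaller w a w-unique (∈-resp-↭ v↭w a∈v) ⟩
    suc (length (filter (λ b → b <? a) w))        ≡⟨ cong suc (↭-length (filter-↭ (λ b → b <? a) (↭-sym v↭w))) ⟩
    suc (length (filter (λ b → b <? a) v))        ≡⟨ cong suc (filter-count (λ b → b <? a) v) ⟩
    suc (count (smaller a) 1 m)                   ≡⟨ cong suc (count-around (smaller a) p≥1 p≤m) ⟩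
    suc (count (smaller a) 1 (p ∸ 1) + (bit (smaller a p) + after p))
      ≡⟨ cong₂ (λ x y → suc (x + (bit y + after p)))
               (count-split (smaller a) (opening≥1 p≥1) (opening-≤ 𝔍 p)) (dec-false (a <? a) (<-irrefl refl)) ⟩
    suc (before p + inside p + after p)           ∎
    where
    open ≤-Reasoning
    a = at v p
    a∈v = at-∈ v p p≥1 p≤m

  opening-bound : ∀ {p} → 1 ≤ p → p ≤ m → opening 𝔍 p ≤ suc (before p + after p)
  opening-bound {p} p≥1 p≤m = +-cancelʳ-≤ (inside p) (opening 𝔍 p) (suc (before p + after p)) (begin
    opening 𝔍 p + inside p               ≡⟨ label-at p≥1 p≤m ⟩
    contr w (at v p)                     ≤⟨ contr-w-bound p≥1 p≤m ⟩
    suc (before p + inside p + after p)  ≡⟨ cong suc (trans (+-assoc (before p) _ _)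
      (trans (cong (before p +_) (+-comm (inside p) (after p))) (sym (+-assoc (before p) _ _)))) ⟩
    suc (before p + after p) + inside p  ∎)
    where open ≤-Reasoning

  LeftClear : ℕ → Set
  LeftClear p = ∀ k → 1 ≤ k → k < opening 𝔍 p → ¬ (at v p < at v k)

  larger-left⇒smaller-right : ∀ {p k} → 1 ≤ p → p ≤ m → 1 ≤ k → k < opening 𝔍 p → at v p < at v k →
    ∃ λ i → p < i × i ≤ m × at v i < at v p
  larger-left⇒smaller-right {p} {k} p≥1 p≤m k≥1 k<s vp<vk
    with count-witness (smaller (at v p)) (suc p) (m ∸ p) (positive-rest (opening-bound p≥1 p≤m) before<)
    where
    before< : before p < opening 𝔍 p ∸ 1
    before< = count-< (smaller (at v p)) 1 (opening 𝔍 p ∸ 1) k k≥1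
      (subst (k <_) (sym (suc-∸1 (opening≥1 p≥1))) k<s) (dec-false (at v k <? at v p) (<⇒≯ vp<vk))
  ... | i , p<i , i<1+m , vi<vp = i , p<i , ≤-pred (subst (i <_) (cong suc (m+[n∸m]≡n p≤m)) i<1+m) , less-sound vi<vp

  no-larger-left : ∀ {p} → 1 ≤ p → p ≤ m → LeftClear p
  no-larger-left {p} p≥1 p≤m = <-rec ClearAtValue step (at v p) p p≥1 p≤m refl
    where
    ClearAtValue : ℕ → Set
    ClearAtValue a = ∀ p → 1 ≤ p → p ≤ m → at v p ≡ a → LeftClear p
    step : ∀ a → (∀ {b} → b < a → ClearAtValue b) → ClearAtValue a
    step _ ih p p≥1 p≤m refl k k≥1 k<s vp<vk with larger-left⇒smaller-right p≥1 p≤m k≥1 k<s vp<vk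
    ... | i , p<i , i≤m , vi<vp with p <? opening 𝔍 i | ih vi<vp i (≤-trans p≥1 (<⇒≤ p<i)) i≤m refl
    ...   | yes p<si | clear-i = clear-i p p≥1 p<si vi<vp
    ...   | no p≮si  | clear-i = clear-i k k≥1
      (<-≤-trans k<s (opening-window 𝔍 ordered (≮⇒≥ p≮si) (<⇒≤ p<i))) (<-trans vi<vp vp<vk)

  before-all : ∀ {p} → 1 ≤ p → p ≤ m → before p ≡ opening 𝔍 p ∸ 1
  before-all {p} p≥1 p≤m = count-all (smaller (at v p)) 1 (opening 𝔍 p ∸ 1) λ k k≥1 k<s′ →
    let k<s = subst (k <_) (suc-∸1 (opening≥1 p≥1)) k<s′
        k<p = <-≤-trans k<s (opening-≤ 𝔍 p)
        vk≢vp = λ e → <-irrefl (at-injective v v-unique k≥1 (≤-trans (<⇒≤ k<p) p≤m) p≥1 p≤m e) k<p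
    in dec-true (at v k <? at v p) (≤∧≢⇒< (≮⇒≥ (no-larger-left p≥1 p≤m k k≥1 k<s)) vk≢vp)

  contr-v≡contr-w : ∀ {p} → 1 ≤ p → p ≤ m → contr v (at v p) ≡ contr w (at v p)
  contr-v≡contr-w {p} p≥1 p≤m = begin
    contr v (at v p)                  ≡⟨ contr-v-at p≥1 p≤m ⟩
    suc (before p + inside p)         ≡⟨ cong (λ t → suc (t + inside p)) (before-all p≥1 p≤m) ⟩
    suc (opening 𝔍 p ∸ 1) + inside p  ≡⟨ cong (_+ inside p) (suc-∸1 (opening≥1 p≥1)) ⟩
    opening 𝔍 p + inside p            ≡⟨ label-at p≥1 p≤m ⟩
    contr w (at v p)                  ∎
    where open ≡-Reasoning

  v≡w : v ≡ w
  v≡w = contr-injective v w v-unique w-unique v↭w λ a a∈v →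
    let index≥1 , index≤m = index-bounds v a a∈v in
    subst (λ x → contr v x ≡ contr w x) (at-index v a a∈v) (contr-v≡contr-w index≥1 index≤m)

  inversion-covered : ∀ {k l} → Inv v k l →
    ∃ λ c → (opening 𝔍 l , c) ∈ 𝔍 × opening 𝔍 l ≤ k × l ≤ c
  inversion-covered {k} {l} (k≥1 , k<l , l≤m , vl<vk) =
    let c , mem , l≤c = opening-member 𝔍 l (≤-<-trans s≤k k<l) in c , mem , s≤k , l≤c
    where
    s≤k : opening 𝔍 l ≤ k
    s≤k = ≮⇒≥ λ k<s → no-larger-left (≤-trans k≥1 (<⇒≤ k<l)) l≤m k k≥1 k<s vl<vk

  member⇒maxinv : ∀ {o c} → (o , c) ∈ 𝔍 → MaxInv v o c
  member⇒maxinv mem = All.lookup members-inv mem , λ k l inv k≤o c≤l →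
    let c′ , mem′ , s≤k , l≤c′ = inversion-covered inv
        s≡o , c′≡c = members-unnested 𝔍 ordered mem mem′ (≤-trans s≤k k≤o) (≤-trans c≤l l≤c′)
    in ≤-antisym k≤o (subst (_≤ _) s≡o s≤k) , ≤-antisym (subst (_ ≤_) c′≡c l≤c′) c≤l

  maxinv⇒member : ∀ {o c} → MaxInv v o c → (o , c) ∈ 𝔍
  maxinv⇒member (inv , maximal) =
    let c′ , mem , s≤o , c≤c′ = inversion-covered inv
        s≡o , c′≡c = maximal _ c′ (All.lookup members-inv mem) s≤o c≤c′
    in subst₂ (λ x y → (x , y) ∈ 𝔍) s≡o c′≡c mem

-- the lemma: A is increasing, so v has no repetitions, and w is a rearrangement of v
lemma3p2 : (n : ℕ) (A v w : List ℕ) (𝔍 : List Interval) →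
    IsSubsetOf[n] n A → InW A v → InW A w → ValidPair v 𝔍 →
    (∀ a → a ∈ A → label v 𝔍 a ≡ contr w a) →
    v ≡ w × (∀ o c → ((o , c) ∈ 𝔍) ⇔ MaxInv v o c)
lemma3p2 n A v w 𝔍 (A-increasing , _) v↭A w↭A valid labels =
  v≡w , λ o c → mk⇔ member⇒maxinv maxinv⇒member
  where
  A-unique : Unique A
  A-unique = AllPairs.map (λ a<b a≡b → <-irrefl a≡b a<b) (Linked⇒AllPairs <-trans A-increasing)
  open FromLabelling v w 𝔍 (unique-resp-↭ (↭-sym v↭A) A-unique) (↭-trans v↭A (↭-sym w↭A)) valid
    (λ a a∈v → labels a (∈-resp-↭ v↭A a∈v))
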